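{- For every integer $j\ge 1$: $$S^{*}(2,j)=\frac{(-1)^{j-1}}{j!},\qquad S^{*}(3,j)=\frac{(-1)^{j-1}}{j!}H_j,\qquad S^{*}(4,j)=\frac{(-1)^{j-1}}{2\,j!}\left(H_j^2+H_j^{(2)}\right),$$ $$S^{*}(5,j)=\frac{(-1)^{j-1}}{6\,j!}\left(H_j^3+3H_jH_j^{(2)}+2H_j^{(3)}\right),$$ $$S^{*}(6,j)=\frac{(-1)^{j-1}}{24\,j!}\left(H_j^4+6H_j^2H_j^{(2)}+3\left(H_j^{(2)}\right)^2+8H_jH_j^{(3)}+6H_j^{(4)}\right).$$
   Context: For integers $k\ge 2$ and $j\ge 1$, $S^{*}(k,j)=\frac{1}{j!}\sum_{m=1}^{j}\binom{j}{m}\frac{(-1)^{j-m}}{m^{k-2}}$. For a real $r$ and integer $n\ge0$, $H_n^{(r)}=\sum_{i=1}^{n} i^{ -r}$ (so $H_0^{(r)}=0$), and $H_n=H_n^{(1)}$. -}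

module Defs where

open import Data.Nat as ℕ using (ℕ; zero; suc)
open import Data.Nat.Combinatorics using (_C_)
import Data.Nat.Properties as ℕP
open import Data.Integer as ℤ using (ℤ; +_)
open import Data.Rational using (ℚ; 0ℚ; 1ℚ; _+_; _*_; _-_; -_; _/_)

sgn : ℕ → ℚ
sgn zero    = 1ℚ
sgn (suc n) = - sgn n

ℕ→ℚ : ℕ → ℚ
ℕ→ℚ n = + n / 1

invPow : ℕ → ℕ → ℚ
invPow i r = + 1 / (suc i ℕ.^ r)
  where instance
    nz : ℕ.NonZero (suc i ℕ.^ r)
    nz = ℕP.m^n≢0 (suc i) r

invFact : ℕ → ℚ
invFact n = + 1 / (n ℕ.!)
  where instance
    nz : ℕ.NonZero (n ℕ.!)
    nz = (n ℕP.!≢0)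

sumFrom1 : ℕ → (ℕ → ℚ) → ℚ
sumFrom1 zero    f = 0ℚ
sumFrom1 (suc j) f = sumFrom1 j f + f (suc j)

Sstar : ℕ → ℕ → ℚ
Sstar k j = invFact j * sumFrom1 j (λ m →
  ℕ→ℚ (j C m) * sgn (j ℕ.∸ m) * invPow (m ℕ.∸ 1) (k ℕ.∸ 2))

H : ℕ → ℕ → ℚ
H r n = sumFrom1 n (λ i → invPow (i ℕ.∸ 1) r)

-- Writing (-1)^(j-m) = (-1)^(j-1) (-1)^(m-1) gives
--   S*(r+2, j) = (-1)^(j-1)/j! · A_r(j),   A_r(j) = Σ_{m=1}^{j} C(j,m) (-1)^(m-1) / m^r.
-- Pascal's rule together with the absorption identity C(j,m)/(m+1) = C(j+1,m+1)/(j+1) gives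
--   A_0(j+1) = 1  and  A_{r+1}(j+1) = A_{r+1}(j) + A_r(j+1)/(j+1),
-- which is the defining recurrence of the complete homogeneous symmetric polynomial
-- h_r(1, 1/2, …, 1/j).  Finally h_r is the cycle index of the symmetric group S_r evaluated at
-- the power sums p_k = H_j^(k); for r ≤ 4 this is checked by induction on the number of
-- variables, each step being a polynomial identity.
module Submission where

open import Level using (0ℓ)
open import Data.Nat as ℕ using (ℕ; zero; suc; _≥_; _≤_; _∸_; s≤s; z≤n)
import Data.Nat.Properties as ℕP
open import Data.Nat.Combinatorics using (_C_; nCk+nC[k+1]≡[n+1]C[k+1]; k>n⇒nCk≡0; nC1≡n)
import Data.Nat.Tactic.RingSolver as ℕ-Solver
open import Data.Integer as ℤ using (+_)
import Data.Integer.Properties as ℤP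
open import Data.Rational using (ℚ; 0ℚ; 1ℚ; _+_; _*_; _/_; -_; fromℚᵘ; toℚᵘ)
import Data.Rational.Properties as ℚP
open import Data.Rational.Unnormalised as ℚᵘ using (mkℚᵘ; *≡*)
import Data.Rational.Unnormalised.Properties as ℚᵘP
open import Data.Product using (_×_; _,_)
open import Algebra.Definitions.RawSemiring ℚP.+-*-rawSemiring using (_^′_)
open import Relation.Nullary.Decidable.Core using (dec⇒maybe)
import Tactic.RingSolver.Core.AlmostCommutativeRing as ACR
open import Tactic.RingSolver using (solve-∀)
open import Relation.Binary.PropositionalEquality

open import Defs

ℚ-ring : ACR.AlmostCommutativeRing 0ℓ 0ℓ
ℚ-ring = ACR.fromCommutativeRing ℚP.+-*-commutativeRing (λ q → dec⇒maybe (0ℚ ℚP.≟ q))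

fromℚᵘ-homo-+ : ∀ p q → fromℚᵘ (p ℚᵘ.+ q) ≡ fromℚᵘ p + fromℚᵘ q
fromℚᵘ-homo-+ p q = ℚP.toℚᵘ-injective (begin
  toℚᵘ (fromℚᵘ (p ℚᵘ.+ q))                ≈⟨ ℚP.toℚᵘ-fromℚᵘ (p ℚᵘ.+ q) ⟩
  p ℚᵘ.+ q                                ≈⟨ ℚᵘP.+-cong (ℚP.toℚᵘ-fromℚᵘ p) (ℚP.toℚᵘ-fromℚᵘ q) ⟨
  toℚᵘ (fromℚᵘ p) ℚᵘ.+ toℚᵘ (fromℚᵘ q)    ≈⟨ ℚP.toℚᵘ-homo-+ (fromℚᵘ p) (fromℚᵘ q) ⟨
  toℚᵘ (fromℚᵘ p + fromℚᵘ q)              ∎)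
  where open ℚᵘP.≃-Reasoning

fromℚᵘ-homo-* : ∀ p q → fromℚᵘ (p ℚᵘ.* q) ≡ fromℚᵘ p * fromℚᵘ q
fromℚᵘ-homo-* p q = ℚP.toℚᵘ-injective (begin
  toℚᵘ (fromℚᵘ (p ℚᵘ.* q))                ≈⟨ ℚP.toℚᵘ-fromℚᵘ (p ℚᵘ.* q) ⟩
  p ℚᵘ.* q                                ≈⟨ ℚᵘP.*-cong (ℚP.toℚᵘ-fromℚᵘ p) (ℚP.toℚᵘ-fromℚᵘ q) ⟨
  toℚᵘ (fromℚᵘ p) ℚᵘ.* toℚᵘ (fromℚᵘ q)    ≈⟨ ℚP.toℚᵘ-homo-* (fromℚᵘ p) (fromℚᵘ q) ⟨
  toℚᵘ (fromℚᵘ p * fromℚᵘ q)              ∎)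
  where open ℚᵘP.≃-Reasoning

ℕ→ℚ-+ : ∀ m n → ℕ→ℚ (m ℕ.+ n) ≡ ℕ→ℚ m + ℕ→ℚ n
ℕ→ℚ-+ m n = trans (ℚP.fromℚᵘ-cong {mkℚᵘ (+ (m ℕ.+ n)) 0} {p ℚᵘ.+ q} (*≡* (cong (ℤ._* + 1) +-eq)))
                  (fromℚᵘ-homo-+ p q)
  where
  p = mkℚᵘ (+ m) 0
  q = mkℚᵘ (+ n) 0
  +-eq : + (m ℕ.+ n) ≡ + m ℤ.* + 1 ℤ.+ + n ℤ.* + 1
  +-eq = trans (ℤP.pos-+ m n) (sym (cong₂ ℤ._+_ (ℤP.*-identityʳ (+ m)) (ℤP.*-identityʳ (+ n))))

ℕ→ℚ-* : ∀ m n → ℕ→ℚ (m ℕ.* n) ≡ ℕ→ℚ m * ℕ→ℚ n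
ℕ→ℚ-* m n = trans (ℚP.fromℚᵘ-cong {mkℚᵘ (+ (m ℕ.* n)) 0} {p ℚᵘ.* q} (*≡* (cong (ℤ._* + 1) (ℤP.pos-* m n))))
                  (fromℚᵘ-homo-* p q)
  where
  p = mkℚᵘ (+ m) 0
  q = mkℚᵘ (+ n) 0

-- Both rest on + 1 / suc k being, by definition, fromℚᵘ (mkℚᵘ (+ 1) k).
ℕ→ℚ-inverseʳ : ∀ n .{{_ : ℕ.NonZero n}} → ℕ→ℚ n * (+ 1 / n) ≡ 1ℚ
ℕ→ℚ-inverseʳ (suc k) = trans (sym (fromℚᵘ-homo-* p (ℚᵘ.1/ p))) (ℚP.fromℚᵘ-cong (ℚᵘP.*-inverseʳ p))
  where p = mkℚᵘ (+ suc k) 0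

1/[m*n]≡1/m*1/n : ∀ m n .{{_ : ℕ.NonZero m}} .{{_ : ℕ.NonZero n}} →
                  (+ 1 / (m ℕ.* n)) {{ℕP.m*n≢0 m n}} ≡ (+ 1 / m) * (+ 1 / n)
1/[m*n]≡1/m*1/n (suc a) (suc b) = fromℚᵘ-homo-* (mkℚᵘ (+ 1) a) (mkℚᵘ (+ 1) b)

ℕ→ℚ[a]*1/b≡ℕ→ℚ[c]*1/d : ∀ a b c d .{{_ : ℕ.NonZero b}} .{{_ : ℕ.NonZero d}} →
                         a ℕ.* d ≡ c ℕ.* b → ℕ→ℚ a * (+ 1 / b) ≡ ℕ→ℚ c * (+ 1 / d)
ℕ→ℚ[a]*1/b≡ℕ→ℚ[c]*1/d a b c d ad≡cb = begin
  qa * b⁻¹                  ≡⟨ ℚP.*-identityʳ (qa * b⁻¹) ⟨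
  qa * b⁻¹ * 1ℚ             ≡⟨ cong (qa * b⁻¹ *_) (ℕ→ℚ-inverseʳ d) ⟨
  qa * b⁻¹ * (qd * d⁻¹)     ≡⟨ regroup qa b⁻¹ qd d⁻¹ ⟩
  qa * qd * (b⁻¹ * d⁻¹)     ≡⟨ cong (_* (b⁻¹ * d⁻¹)) ad≡cb-in-ℚ ⟩
  qc * qb * (b⁻¹ * d⁻¹)     ≡⟨ regroup′ qc qb b⁻¹ d⁻¹ ⟩
  qc * d⁻¹ * (qb * b⁻¹)     ≡⟨ cong (qc * d⁻¹ *_) (ℕ→ℚ-inverseʳ b) ⟩
  qc * d⁻¹ * 1ℚ             ≡⟨ ℚP.*-identityʳ (qc * d⁻¹) ⟩
  qc * d⁻¹                  ∎
  where
  open ≡-Reasoning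
  qa = ℕ→ℚ a
  qb = ℕ→ℚ b
  qc = ℕ→ℚ c
  qd = ℕ→ℚ d
  b⁻¹ = + 1 / b
  d⁻¹ = + 1 / d
  ad≡cb-in-ℚ : qa * qd ≡ qc * qb
  ad≡cb-in-ℚ = trans (sym (ℕ→ℚ-* a d)) (trans (cong ℕ→ℚ ad≡cb) (ℕ→ℚ-* c b))
  regroup : ∀ (w x y z : ℚ) → w * x * (y * z) ≡ w * y * (x * z)
  regroup = solve-∀ ℚ-ring
  regroup′ : ∀ (w x y z : ℚ) → w * x * (y * z) ≡ w * z * (x * y)
  regroup′ = solve-∀ ℚ-ring

invPow-one : ∀ i → invPow i 1 ≡ + 1 / suc i
invPow-one i = ℚP./-cong {+ 1} {suc i ℕ.* 1} refl (ℕP.*-identityʳ (suc i))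

invPow-suc : ∀ i r → invPow i (suc r) ≡ invPow i 1 * invPow i r
invPow-suc i r = begin
  invPow i (suc r)                ≡⟨ 1/[m*n]≡1/m*1/n (suc i) (suc i ℕ.^ r) {{_}} {{ℕP.m^n≢0 (suc i) r}} ⟩
  (+ 1 / suc i) * invPow i r      ≡⟨ cong (_* invPow i r) (invPow-one i) ⟨
  invPow i 1 * invPow i r         ∎
  where open ≡-Reasoning

invPow≡invPow[1]^′ : ∀ i r → invPow i r ≡ invPow i 1 ^′ r
invPow≡invPow[1]^′ i zero          = refl
invPow≡invPow[1]^′ i (suc zero)    = refl
invPow≡invPow[1]^′ i (suc (suc r)) = begin
  invPow i (2 ℕ.+ r)              ≡⟨ invPow-suc i (suc r) ⟩
  invPow i 1 * invPow i (suc r)   ≡⟨ ℚP.*-comm (invPow i 1) _ ⟩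
  invPow i (suc r) * invPow i 1   ≡⟨ cong (_* invPow i 1) (invPow≡invPow[1]^′ i (suc r)) ⟩
  invPow i 1 ^′ (2 ℕ.+ r)         ∎
  where open ≡-Reasoning

sgn-+ : ∀ m n → sgn (m ℕ.+ n) ≡ sgn m * sgn n
sgn-+ zero    n = sym (ℚP.*-identityˡ (sgn n))
sgn-+ (suc m) n = trans (cong -_ (sgn-+ m n)) (ℚP.neg-distribˡ-* (sgn m) (sgn n))

sgn*sgn≡1 : ∀ n → sgn n * sgn n ≡ 1ℚ
sgn*sgn≡1 zero    = refl
sgn*sgn≡1 (suc n) = trans (neg*neg (sgn n)) (sgn*sgn≡1 n)
  where
  neg*neg : ∀ (x : ℚ) → - x * - x ≡ x * x
  neg*neg = solve-∀ ℚ-ring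

sgn[n∸m]≡sgn[n∸1]*sgn[m∸1] : ∀ {m n} → 1 ≤ m → m ≤ n → sgn (n ∸ m) ≡ sgn (n ∸ 1) * sgn (m ∸ 1)
sgn[n∸m]≡sgn[n∸1]*sgn[m∸1] {suc m} {suc n} _ (s≤s m≤n) = begin
  sgn (n ∸ m)                         ≡⟨ ℚP.*-identityʳ (sgn (n ∸ m)) ⟨
  sgn (n ∸ m) * 1ℚ                    ≡⟨ cong (sgn (n ∸ m) *_) (sgn*sgn≡1 m) ⟨
  sgn (n ∸ m) * (sgn m * sgn m)       ≡⟨ ℚP.*-assoc (sgn (n ∸ m)) (sgn m) (sgn m) ⟨
  sgn (n ∸ m) * sgn m * sgn m         ≡⟨ cong (_* sgn m) (sgn-+ (n ∸ m) m) ⟨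
  sgn (n ∸ m ℕ.+ m) * sgn m           ≡⟨ cong (λ k → sgn k * sgn m) (ℕP.m∸n+n≡m m≤n) ⟩
  sgn n * sgn m                       ∎
  where open ≡-Reasoning

sumFrom1-cong : ∀ n {f g : ℕ → ℚ} → (∀ {m} → 1 ≤ m → m ≤ n → f m ≡ g m) →
                sumFrom1 n f ≡ sumFrom1 n g
sumFrom1-cong zero    f≗g = refl
sumFrom1-cong (suc n) f≗g =
  cong₂ _+_ (sumFrom1-cong n (λ 1≤m m≤n → f≗g 1≤m (ℕP.m≤n⇒m≤1+n m≤n))) (f≗g (s≤s z≤n) ℕP.≤-refl)

sumFrom1-distrib-+ : ∀ n (f g : ℕ → ℚ) →
                     sumFrom1 n (λ m → f m + g m) ≡ sumFrom1 n f + sumFrom1 n g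
sumFrom1-distrib-+ zero    f g = refl
sumFrom1-distrib-+ (suc n) f g = trans (cong (_+ (f (suc n) + g (suc n))) (sumFrom1-distrib-+ n f g))
                                       (swap (sumFrom1 n f) (sumFrom1 n g) (f (suc n)) (g (suc n)))
  where
  swap : ∀ (w x y z : ℚ) → w + x + (y + z) ≡ w + y + (x + z)
  swap = solve-∀ ℚ-ring

*-distribˡ-sumFrom1 : ∀ n c (f : ℕ → ℚ) → c * sumFrom1 n f ≡ sumFrom1 n (λ m → c * f m)
*-distribˡ-sumFrom1 zero    c f = ℚP.*-zeroʳ c
*-distribˡ-sumFrom1 (suc n) c f = trans (ℚP.*-distribˡ-+ c (sumFrom1 n f) (f (suc n)))
                                        (cong (_+ c * f (suc n)) (*-distribˡ-sumFrom1 n c f))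

neg-distrib-sumFrom1 : ∀ n (f : ℕ → ℚ) → - sumFrom1 n f ≡ sumFrom1 n (λ m → - f m)
neg-distrib-sumFrom1 zero    f = refl
neg-distrib-sumFrom1 (suc n) f = trans (ℚP.neg-distrib-+ (sumFrom1 n f) (f (suc n)))
                                       (cong (_+ - f (suc n)) (neg-distrib-sumFrom1 n f))

sumFrom1-suc : ∀ n (f : ℕ → ℚ) → sumFrom1 (suc n) f ≡ f 1 + sumFrom1 n (λ m → f (suc m))
sumFrom1-suc zero    f = trans (ℚP.+-identityˡ (f 1)) (sym (ℚP.+-identityʳ (f 1)))
sumFrom1-suc (suc n) f = trans (cong (_+ f (2 ℕ.+ n)) (sumFrom1-suc n f)) (ℚP.+-assoc (f 1) _ _)

sumFrom1-pascal : ∀ n (g : ℕ → ℚ) →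
  sumFrom1 (suc n) (λ m → ℕ→ℚ (suc n C m) * g m)
  ≡ sumFrom1 n (λ m → ℕ→ℚ (n C m) * g m) + sumFrom1 (suc n) (λ m → ℕ→ℚ (n C (m ∸ 1)) * g m)
sumFrom1-pascal n g = begin
  sumFrom1 (suc n) (λ m → ℕ→ℚ (suc n C m) * g m)      ≡⟨ sumFrom1-cong (suc n) split ⟩
  sumFrom1 (suc n) (λ m → lower m + upper m)           ≡⟨ sumFrom1-distrib-+ (suc n) lower upper ⟩
  sumFrom1 n lower + lower (suc n) + sumFrom1 (suc n) upper
    ≡⟨ cong (λ k → sumFrom1 n lower + ℕ→ℚ k * g (suc n) + sumFrom1 (suc n) upper) (k>n⇒nCk≡0 (ℕP.n<1+n n)) ⟩
  sumFrom1 n lower + 0ℚ * g (suc n) + sumFrom1 (suc n) upper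
    ≡⟨ cong (λ x → sumFrom1 n lower + x + sumFrom1 (suc n) upper) (ℚP.*-zeroˡ (g (suc n))) ⟩
  sumFrom1 n lower + 0ℚ + sumFrom1 (suc n) upper
    ≡⟨ cong (_+ sumFrom1 (suc n) upper) (ℚP.+-identityʳ (sumFrom1 n lower)) ⟩
  sumFrom1 n lower + sumFrom1 (suc n) upper           ∎
  where
  open ≡-Reasoning
  lower upper : ℕ → ℚ
  lower m = ℕ→ℚ (n C m) * g m
  upper m = ℕ→ℚ (n C (m ∸ 1)) * g m
  split : ∀ {m} → 1 ≤ m → m ≤ suc n → ℕ→ℚ (suc n C m) * g m ≡ lower m + upper m
  split {suc m} _ _ = begin
    ℕ→ℚ (suc n C suc m) * g (suc m)                       ≡⟨ cong (λ k → ℕ→ℚ k * g (suc m)) pascal ⟩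
    ℕ→ℚ (n C suc m ℕ.+ n C m) * g (suc m)                  ≡⟨ cong (_* g (suc m)) (ℕ→ℚ-+ (n C suc m) (n C m)) ⟩
    (ℕ→ℚ (n C suc m) + ℕ→ℚ (n C m)) * g (suc m)            ≡⟨ ℚP.*-distribʳ-+ (g (suc m)) (ℕ→ℚ (n C suc m)) (ℕ→ℚ (n C m)) ⟩
    lower (suc m) + upper (suc m)                          ∎
    where
    pascal : suc n C suc m ≡ n C suc m ℕ.+ n C m
    pascal = trans (sym (nCk+nC[k+1]≡[n+1]C[k+1] n m)) (ℕP.+-comm (n C m) (n C suc m))

[k+1]*[n+1]C[k+1]≡[n+1]*nCk : ∀ n k → suc k ℕ.* (suc n C suc k) ≡ suc n ℕ.* (n C k)
[k+1]*[n+1]C[k+1]≡[n+1]*nCk zero    zero    = refl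
[k+1]*[n+1]C[k+1]≡[n+1]*nCk zero    (suc k) rewrite k>n⇒nCk≡0 {1} {2 ℕ.+ k} (s≤s (s≤s z≤n))
                                              | k>n⇒nCk≡0 {0} {suc k} (s≤s z≤n) = ℕP.*-zeroʳ (2 ℕ.+ k)
[k+1]*[n+1]C[k+1]≡[n+1]*nCk (suc n) zero    =
  trans (ℕP.*-identityˡ _) (trans (nC1≡n (2 ℕ.+ n)) (sym (ℕP.*-identityʳ (2 ℕ.+ n))))
[k+1]*[n+1]C[k+1]≡[n+1]*nCk (suc n) (suc k) = begin
  (2 ℕ.+ k) ℕ.* (suc (suc n) C suc (suc k))                    ≡⟨ cong ((2 ℕ.+ k) ℕ.*_) (pascal (suc n) (suc k)) ⟩
  (2 ℕ.+ k) ℕ.* (P ℕ.+ Q)                                   ≡⟨ expand k P Q ⟩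
  P ℕ.+ suc k ℕ.* P ℕ.+ (2 ℕ.+ k) ℕ.* Q
    ≡⟨ cong₂ (λ u v → P ℕ.+ u ℕ.+ v) ([k+1]*[n+1]C[k+1]≡[n+1]*nCk n k) ([k+1]*[n+1]C[k+1]≡[n+1]*nCk n (suc k)) ⟩
  P ℕ.+ suc n ℕ.* (n C k) ℕ.+ suc n ℕ.* (n C suc k)         ≡⟨ ℕP.+-assoc P _ _ ⟩
  P ℕ.+ (suc n ℕ.* (n C k) ℕ.+ suc n ℕ.* (n C suc k))       ≡⟨ cong (P ℕ.+_) (ℕP.*-distribˡ-+ (suc n) (n C k) (n C suc k)) ⟨
  P ℕ.+ suc n ℕ.* (n C k ℕ.+ n C suc k)                     ≡⟨ cong (λ u → P ℕ.+ suc n ℕ.* u) (pascal n k) ⟨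
  (2 ℕ.+ n) ℕ.* P                                          ∎
  where
  open ≡-Reasoning
  P = suc n C suc k
  Q = suc n C suc (suc k)
  pascal : ∀ n k → suc n C suc k ≡ n C k ℕ.+ n C suc k
  pascal n k = sym (nCk+nC[k+1]≡[n+1]C[k+1] n k)
  expand : ∀ k P Q → (2 ℕ.+ k) ℕ.* (P ℕ.+ Q) ≡ P ℕ.+ suc k ℕ.* P ℕ.+ (2 ℕ.+ k) ℕ.* Q
  expand = ℕ-Solver.solve-∀

nCk*invPow[k]≡invPow[n]*[n+1]C[k+1] : ∀ n k → ℕ→ℚ (n C k) * invPow k 1 ≡ invPow n 1 * ℕ→ℚ (suc n C suc k)
nCk*invPow[k]≡invPow[n]*[n+1]C[k+1] n k = begin
  ℕ→ℚ (n C k) * invPow k 1               ≡⟨ cong (ℕ→ℚ (n C k) *_) (invPow-one k) ⟩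
  ℕ→ℚ (n C k) * (+ 1 / suc k)            ≡⟨ ℕ→ℚ[a]*1/b≡ℕ→ℚ[c]*1/d (n C k) (suc k) (suc n C suc k) (suc n) cross ⟩
  ℕ→ℚ (suc n C suc k) * (+ 1 / suc n)    ≡⟨ cong (ℕ→ℚ (suc n C suc k) *_) (invPow-one n) ⟨
  ℕ→ℚ (suc n C suc k) * invPow n 1       ≡⟨ ℚP.*-comm (ℕ→ℚ (suc n C suc k)) (invPow n 1) ⟩
  invPow n 1 * ℕ→ℚ (suc n C suc k)       ∎
  where
  open ≡-Reasoning
  cross : (n C k) ℕ.* suc n ≡ (suc n C suc k) ℕ.* suc k
  cross = trans (ℕP.*-comm (n C k) (suc n))
         (trans (sym ([k+1]*[n+1]C[k+1]≡[n+1]*nCk n k)) (ℕP.*-comm (suc k) (suc n C suc k)))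

alternatingBinomialSum : ℕ → ℕ → ℚ
alternatingBinomialSum r n = sumFrom1 n (λ m → ℕ→ℚ (n C m) * (sgn (m ∸ 1) * invPow (m ∸ 1) r))

alternatingBinomialSum-zero : ∀ n → alternatingBinomialSum 0 (suc n) ≡ 1ℚ
alternatingBinomialSum-zero n = begin
  alternatingBinomialSum 0 (suc n)                          ≡⟨ sumFrom1-pascal n w ⟩
  A + sumFrom1 (suc n) (λ m → ℕ→ℚ (n C (m ∸ 1)) * w m)      ≡⟨ cong (λ x → A + x) (sumFrom1-suc n _) ⟩
  A + (1ℚ + sumFrom1 n (λ m → ℕ→ℚ (n C m) * w (suc m)))     ≡⟨ cong (λ x → A + (1ℚ + x)) (sumFrom1-cong n flip-sign) ⟩
  A + (1ℚ + sumFrom1 n (λ m → - (ℕ→ℚ (n C m) * w m)))       ≡⟨ cong (λ x → A + (1ℚ + x)) (neg-distrib-sumFrom1 n _) ⟨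
  A + (1ℚ + - A)                                            ≡⟨ cancel A ⟩
  1ℚ                                                        ∎
  where
  open ≡-Reasoning
  A = alternatingBinomialSum 0 n
  -- n C 0 and invPow i 0 compute to 1, which produces the 1ℚ terms above and in flip-sign.
  w : ℕ → ℚ
  w m = sgn (m ∸ 1) * invPow (m ∸ 1) 0
  flip-sign : ∀ {m} → 1 ≤ m → m ≤ n → ℕ→ℚ (n C m) * w (suc m) ≡ - (ℕ→ℚ (n C m) * w m)
  flip-sign {suc m} _ _ = neg-pull (ℕ→ℚ (n C suc m)) (sgn m)
    where
    neg-pull : ∀ (c s : ℚ) → c * (- s * 1ℚ) ≡ - (c * (s * 1ℚ))
    neg-pull = solve-∀ ℚ-ring
  cancel : ∀ (a : ℚ) → a + (1ℚ + - a) ≡ 1ℚ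
  cancel = solve-∀ ℚ-ring

alternatingBinomialSum-suc : ∀ r n →
  alternatingBinomialSum (suc r) (suc n) ≡ alternatingBinomialSum (suc r) n + invPow n 1 * alternatingBinomialSum r (suc n)
alternatingBinomialSum-suc r n = begin
  alternatingBinomialSum (suc r) (suc n)
    ≡⟨ sumFrom1-pascal n (w (suc r)) ⟩
  alternatingBinomialSum (suc r) n + sumFrom1 (suc n) (λ m → ℕ→ℚ (n C (m ∸ 1)) * w (suc r) m)
    ≡⟨ cong (λ x → alternatingBinomialSum (suc r) n + x) (sumFrom1-cong (suc n) absorb) ⟩
  alternatingBinomialSum (suc r) n + sumFrom1 (suc n) (λ m → invPow n 1 * (ℕ→ℚ (suc n C m) * w r m))
    ≡⟨ cong (λ x → alternatingBinomialSum (suc r) n + x) (*-distribˡ-sumFrom1 (suc n) (invPow n 1) _) ⟨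
  alternatingBinomialSum (suc r) n + invPow n 1 * alternatingBinomialSum r (suc n) ∎
  where
  open ≡-Reasoning
  w : ℕ → ℕ → ℚ
  w r m = sgn (m ∸ 1) * invPow (m ∸ 1) r
  absorb : ∀ {m} → 1 ≤ m → m ≤ suc n → ℕ→ℚ (n C (m ∸ 1)) * w (suc r) m ≡ invPow n 1 * (ℕ→ℚ (suc n C m) * w r m)
  absorb {suc k} _ _ = begin
    c * (s * invPow k (suc r))              ≡⟨ cong (λ x → c * (s * x)) (invPow-suc k r) ⟩
    c * (s * (invPow k 1 * invPow k r))     ≡⟨ regroup c s (invPow k 1) (invPow k r) ⟩
    c * invPow k 1 * (s * invPow k r)       ≡⟨ cong (_* (s * invPow k r)) (nCk*invPow[k]≡invPow[n]*[n+1]C[k+1] n k) ⟩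
    invPow n 1 * c′ * (s * invPow k r)      ≡⟨ ℚP.*-assoc (invPow n 1) c′ (s * invPow k r) ⟩
    invPow n 1 * (c′ * (s * invPow k r))    ∎
    where
    c = ℕ→ℚ (n C k)
    c′ = ℕ→ℚ (suc n C suc k)
    s = sgn k
    regroup : ∀ (a b x y : ℚ) → a * (b * (x * y)) ≡ a * x * (b * y)
    regroup = solve-∀ ℚ-ring

cycleIndex₂ : ℚ → ℚ → ℚ
cycleIndex₂ p₁ p₂ = (+ 1 / 2) * (p₁ * p₁ + p₂)

cycleIndex₃ : ℚ → ℚ → ℚ → ℚ
cycleIndex₃ p₁ p₂ p₃ = (+ 1 / 6) * (p₁ * p₁ * p₁ + ℕ→ℚ 3 * p₁ * p₂ + ℕ→ℚ 2 * p₃)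

cycleIndex₄ : ℚ → ℚ → ℚ → ℚ → ℚ
cycleIndex₄ p₁ p₂ p₃ p₄ = (+ 1 / 24) * (p₁ * p₁ * p₁ * p₁ + ℕ→ℚ 6 * p₁ * p₁ * p₂
                                       + ℕ→ℚ 3 * p₂ * p₂ + ℕ→ℚ 8 * p₁ * p₃ + ℕ→ℚ 6 * p₄)

module SymmetricFunctions (x : ℕ → ℚ) where

  completeHomogeneous : ℕ → ℕ → ℚ
  completeHomogeneous zero    n       = 1ℚ
  completeHomogeneous (suc r) zero    = 0ℚ
  completeHomogeneous (suc r) (suc n) = completeHomogeneous (suc r) n + x (suc n) * completeHomogeneous r (suc n)

  -- _^′_ rather than _^_ so that x ^′ 2 unfolds to x * x, the form used in the ring identities below.
  powerSum : ℕ → ℕ → ℚ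
  powerSum k n = sumFrom1 n (λ i → x i ^′ k)

  private
    h = completeHomogeneous
    p = powerSum

  h₁≡p₁ : ∀ n → h 1 n ≡ p 1 n
  h₁≡p₁ zero    = refl
  h₁≡p₁ (suc n) = cong₂ _+_ (h₁≡p₁ n) (ℚP.*-identityʳ (x (suc n)))

  h₂≡cycleIndex₂ : ∀ n → h 2 n ≡ cycleIndex₂ (p 1 n) (p 2 n)
  h₂≡cycleIndex₂ zero    = refl
  h₂≡cycleIndex₂ (suc n) =
    trans (cong₂ (λ u v → u + x (suc n) * v) (h₂≡cycleIndex₂ n) (h₁≡p₁ (suc n))) (step (p 1 n) (p 2 n) (x (suc n)))
    where
    step : ∀ (a b y : ℚ) → (+ 1 / 2) * (a * a + b) + y * (a + y)
                          ≡ (+ 1 / 2) * ((a + y) * (a + y) + (b + y * y))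
    step = solve-∀ ℚ-ring

  h₃≡cycleIndex₃ : ∀ n → h 3 n ≡ cycleIndex₃ (p 1 n) (p 2 n) (p 3 n)
  h₃≡cycleIndex₃ zero    = refl
  h₃≡cycleIndex₃ (suc n) =
    trans (cong₂ (λ u v → u + x (suc n) * v) (h₃≡cycleIndex₃ n) (h₂≡cycleIndex₂ (suc n))) (step (p 1 n) (p 2 n) (p 3 n) (x (suc n)))
    where
    step : ∀ (a b c y : ℚ) →
      (+ 1 / 6) * (a * a * a + ℕ→ℚ 3 * a * b + ℕ→ℚ 2 * c) + y * ((+ 1 / 2) * ((a + y) * (a + y) + (b + y * y)))
      ≡ (+ 1 / 6) * ((a + y) * (a + y) * (a + y) + ℕ→ℚ 3 * (a + y) * (b + y * y) + ℕ→ℚ 2 * (c + y * y * y))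
    step = solve-∀ ℚ-ring

  h₄≡cycleIndex₄ : ∀ n → h 4 n ≡ cycleIndex₄ (p 1 n) (p 2 n) (p 3 n) (p 4 n)
  h₄≡cycleIndex₄ zero    = refl
  h₄≡cycleIndex₄ (suc n) =
    trans (cong₂ (λ u v → u + x (suc n) * v) (h₄≡cycleIndex₄ n) (h₃≡cycleIndex₃ (suc n))) (step (p 1 n) (p 2 n) (p 3 n) (p 4 n) (x (suc n)))
    where
    step : ∀ (a b c d y : ℚ) →
      (+ 1 / 24) * (a * a * a * a + ℕ→ℚ 6 * a * a * b + ℕ→ℚ 3 * b * b + ℕ→ℚ 8 * a * c + ℕ→ℚ 6 * d)
        + y * ((+ 1 / 6) * ((a + y) * (a + y) * (a + y) + ℕ→ℚ 3 * (a + y) * (b + y * y) + ℕ→ℚ 2 * (c + y * y * y)))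
      ≡ (+ 1 / 24) * ((a + y) * (a + y) * (a + y) * (a + y) + ℕ→ℚ 6 * (a + y) * (a + y) * (b + y * y)
                      + ℕ→ℚ 3 * (b + y * y) * (b + y * y) + ℕ→ℚ 8 * (a + y) * (c + y * y * y) + ℕ→ℚ 6 * (d + y * y * y * y))
    step = solve-∀ ℚ-ring

reciprocal : ℕ → ℚ
reciprocal m = invPow (m ∸ 1) 1

open SymmetricFunctions reciprocal

H≡powerSum : ∀ r n → H r n ≡ powerSum r n
H≡powerSum r n = sumFrom1-cong n (λ {m} _ _ → invPow≡invPow[1]^′ (m ∸ 1) r)

alternatingBinomialSum≡completeHomogeneous : ∀ r n →
  alternatingBinomialSum r (suc n) ≡ completeHomogeneous r (suc n)
alternatingBinomialSum≡completeHomogeneous zero    n = alternatingBinomialSum-zero n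
alternatingBinomialSum≡completeHomogeneous (suc r) n =
  trans (alternatingBinomialSum-suc r n)
        (cong₂ (λ u v → u + invPow n 1 * v) (below n) (alternatingBinomialSum≡completeHomogeneous r n))
  where
  below : ∀ n → alternatingBinomialSum (suc r) n ≡ completeHomogeneous (suc r) n
  below zero    = refl
  below (suc n) = alternatingBinomialSum≡completeHomogeneous (suc r) n

Sstar≡sgn*invFact*alternatingBinomialSum : ∀ r n →
  Sstar (2 ℕ.+ r) n ≡ sgn (n ∸ 1) * invFact n * alternatingBinomialSum r n
Sstar≡sgn*invFact*alternatingBinomialSum r n = begin
  invFact n * sumFrom1 n (λ m → ℕ→ℚ (n C m) * sgn (n ∸ m) * invPow (m ∸ 1) r)
    ≡⟨ cong (invFact n *_) (sumFrom1-cong n split-sign) ⟩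
  invFact n * sumFrom1 n (λ m → sgn (n ∸ 1) * (ℕ→ℚ (n C m) * (sgn (m ∸ 1) * invPow (m ∸ 1) r)))
    ≡⟨ cong (invFact n *_) (*-distribˡ-sumFrom1 n (sgn (n ∸ 1)) _) ⟨
  invFact n * (sgn (n ∸ 1) * alternatingBinomialSum r n)
    ≡⟨ swap (invFact n) (sgn (n ∸ 1)) (alternatingBinomialSum r n) ⟩
  sgn (n ∸ 1) * invFact n * alternatingBinomialSum r n ∎
  where
  open ≡-Reasoning
  split-sign : ∀ {m} → 1 ≤ m → m ≤ n →
    ℕ→ℚ (n C m) * sgn (n ∸ m) * invPow (m ∸ 1) r ≡ sgn (n ∸ 1) * (ℕ→ℚ (n C m) * (sgn (m ∸ 1) * invPow (m ∸ 1) r))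
  split-sign {m} 1≤m m≤n = trans (cong (λ s → ℕ→ℚ (n C m) * s * invPow (m ∸ 1) r) (sgn[n∸m]≡sgn[n∸1]*sgn[m∸1] 1≤m m≤n))
                                 (regroup (ℕ→ℚ (n C m)) (sgn (n ∸ 1)) (sgn (m ∸ 1)) (invPow (m ∸ 1) r))
    where
    regroup : ∀ (c s t w : ℚ) → c * (s * t) * w ≡ s * (c * (t * w))
    regroup = solve-∀ ℚ-ring
  swap : ∀ (f s a : ℚ) → f * (s * a) ≡ s * f * a
  swap = solve-∀ ℚ-ring

corollary2p1 : ∀ (j : ℕ) → j ≥ 1 →
  (Sstar 2 j ≡ sgn (j ∸ 1) * invFact j)
  × (Sstar 3 j ≡ sgn (j ∸ 1) * invFact j * H 1 j)
  × (Sstar 4 j ≡ sgn (j ∸ 1) * (+ 1 / 2) * invFact j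
                   * (H 1 j * H 1 j + H 2 j))
  × (Sstar 5 j ≡ sgn (j ∸ 1) * (+ 1 / 6) * invFact j
                   * (H 1 j * H 1 j * H 1 j + ℕ→ℚ 3 * H 1 j * H 2 j
                      + ℕ→ℚ 2 * H 3 j))
  × (Sstar 6 j ≡ sgn (j ∸ 1) * (+ 1 / 24) * invFact j
                   * (H 1 j * H 1 j * H 1 j * H 1 j
                      + ℕ→ℚ 6 * H 1 j * H 1 j * H 2 j
                      + ℕ→ℚ 3 * H 2 j * H 2 j
                      + ℕ→ℚ 8 * H 1 j * H 3 j
                      + ℕ→ℚ 6 * H 4 j))
corollary2p1 (suc n) _ =
    trans (Sstar≡h 0) (ℚP.*-identityʳ (s * f))
  , trans (Sstar≡h 1) (cong (s * f *_) (trans (h₁≡p₁ m) (powerSums≡H (λ a _ _ _ → a))))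
  , Sstar≡closedForm 2 (trans (h₂≡cycleIndex₂ m) (powerSums≡H (λ a b _ _ → cycleIndex₂ a b)))
  , Sstar≡closedForm 3 (trans (h₃≡cycleIndex₃ m) (powerSums≡H (λ a b c _ → cycleIndex₃ a b c)))
  , Sstar≡closedForm 4 (trans (h₄≡cycleIndex₄ m) (powerSums≡H cycleIndex₄))
  where
  m = suc n
  s = sgn n
  f = invFact m
  Sstar≡h : ∀ r → Sstar (2 ℕ.+ r) m ≡ s * f * completeHomogeneous r m
  Sstar≡h r = trans (Sstar≡sgn*invFact*alternatingBinomialSum r m)
                    (cong (s * f *_) (alternatingBinomialSum≡completeHomogeneous r n))
  pull-out : ∀ (s f c e : ℚ) → s * f * (c * e) ≡ s * c * f * e
  pull-out = solve-∀ ℚ-ring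
  Sstar≡closedForm : ∀ r {c e} → completeHomogeneous r m ≡ c * e → Sstar (2 ℕ.+ r) m ≡ s * c * f * e
  Sstar≡closedForm r {c} {e} h≡ce = trans (Sstar≡h r) (trans (cong (s * f *_) h≡ce) (pull-out s f c e))
  powerSums≡H : (F : ℚ → ℚ → ℚ → ℚ → ℚ) →
    F (powerSum 1 m) (powerSum 2 m) (powerSum 3 m) (powerSum 4 m) ≡ F (H 1 m) (H 2 m) (H 3 m) (H 4 m)
  powerSums≡H F = trans (cong₂ (λ a b → F a b (powerSum 3 m) (powerSum 4 m)) (sym (H≡powerSum 1 m)) (sym (H≡powerSum 2 m)))
                        (cong₂ (λ c d → F (H 1 m) (H 2 m) c d) (sym (H≡powerSum 3 m)) (sym (H≡powerSum 4 m)))
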